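{- Let $r\ge3$ be an integer and let $G$ be an $(r+1)$-path degenerate graph with maximum degree $\Delta\ge3$. If $G$ is a forest, then $\mathrm{a}'_r(G)=\Delta$; otherwise $\mathrm{a}'_r(G)=\max\{\Delta,r\}$.
   Context: The generalized $r$-acyclic chromatic index $\mathrm{a}'_r(G)$ is the minimum number of colors in a proper edge coloring of $G$ such that every cycle $C$ of $G$ receives at least $\min\{|C|,r\}$ colors. A strict ear of $G$ is a path with distinct endpoints whose internal vertices have degree $2$ in $G$; a $p$-reduction deletes an isolated vertex, a vertex of degree $1$, or the internal vertices of a strict ear of length at least $p$; $G$ is $p$-path degenerate if it reduces to the empty graph by $p$-reductions. -}

module Defs where

open import Data.Nat using (ℕ; zero; suc; _+_; _≤_; _⊔_; _⊓_)
open import Data.Bool using (Bool; true; false; _∧_; not; if_then_else_)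
open import Data.Fin using (Fin; zero; suc; inject₁; fromℕ)
open import Data.List using (List; length; map; foldr; allFin)
open import Data.List.Relation.Unary.All using (All)
open import Data.List.Relation.Unary.Unique.Propositional using (Unique)
open import Data.Product using (Σ; ∃; ∃-syntax; _×_; _,_)
open import Relation.Binary.PropositionalEquality using (_≡_; _≢_)
open import Relation.Nullary using (¬_)
open import Function using (_⇔_)
open import Function.Definitions using (Injective)

record Graph : Set where
  field
    n      : ℕ
    adj    : Fin n → Fin n → Bool
    sym    : ∀ u v → adj u v ≡ adj v u
    irrefl : ∀ u → adj u u ≡ false
open Graph public

countTrue : ∀ {m} → (Fin m → Bool) → ℕ
countTrue {zero}  f = 0
countTrue {suc m} f = (if f zero then 1 else 0) + countTrue (λ i → f (suc i))

-- vertex subsets (for induced subgraphs)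
VSet : Graph → Set
VSet G = Fin (n G) → Bool

full : (G : Graph) → VSet G
full G _ = true

degIn : (G : Graph) → VSet G → Fin (n G) → ℕ
degIn G S v = countTrue (λ u → adj G v u ∧ S u)

deg : (G : Graph) → Fin (n G) → ℕ
deg G = degIn G (full G)

-- maximum degree Δ(G) (0 for the empty graph)
maxDeg : Graph → ℕ
maxDeg G = foldr _⊔_ 0 (map (deg G) (allFin (n G)))

Internal : ∀ {ℓ} → Fin (suc ℓ) → Set
Internal {ℓ} i = (i ≢ zero) × (i ≢ fromℕ ℓ)

record StrictEar (G : Graph) (S : VSet G) : Set where
  field
    len      : ℕ
    vx       : Fin (suc len) → Fin (n G)
    inj      : Injective _≡_ _≡_ vx
    inS      : ∀ i → S (vx i) ≡ true
    path     : ∀ (i : Fin len) → adj G (vx (inject₁ i)) (vx (suc i)) ≡ true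
    internal : ∀ i → Internal i → degIn G S (vx i) ≡ 2
open StrictEar public

data Step (p : ℕ) (G : Graph) (S : VSet G) (S' : VSet G) : Set where
  delVertex : (v : Fin (n G)) → S v ≡ true → degIn G S v ≤ 1 →
              (∀ u → (S' u ≡ true) ⇔ ((S u ≡ true) × (u ≢ v))) →
              Step p G S S'
  delEar : (E : StrictEar G S) → p ≤ len E →
           (∀ u → (S' u ≡ true) ⇔ ((S u ≡ true) ×
                     ¬ (∃[ i ] (Internal i × (vx E i ≡ u))))) →
           Step p G S S'

data Reduces (p : ℕ) (G : Graph) : VSet G → Set where
  done : ∀ {S} → (∀ u → S u ≡ false) → Reduces p G S
  step : ∀ {S S'} → Step p G S S' → Reduces p G S' → Reduces p G S

PathDegenerate : ℕ → Graph → Set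
PathDegenerate p G = Reduces p G (full G)

csuc : ∀ {k} → Fin (suc k) → Fin (suc k)
csuc {zero}  zero    = zero
csuc {suc k} zero    = suc zero
csuc {suc k} (suc i) with csuc {k} i
... | zero  = zero
... | suc j = suc (suc j)

record Cycle (G : Graph) : Set where
  field
    j    : ℕ
    cv   : Fin (3 + j) → Fin (n G)
    cinj : Injective _≡_ _≡_ cv
    cadj : ∀ i → adj G (cv i) (cv (csuc i)) ≡ true
open Cycle public

cycleLength : ∀ {G} → Cycle G → ℕ
cycleLength C = 3 + j C

IsForest : Graph → Set
IsForest G = ¬ Cycle G

-- edge colourings with k colours (colours Fin k); c u v is the colour of
-- edge uv (values on non-edges are irrelevant)

record EdgeColouring (G : Graph) (k : ℕ) : Set where
  field
    col    : Fin (n G) → Fin (n G) → Fin k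
    colSym : ∀ u v → adj G u v ≡ true → col u v ≡ col v u
    proper : ∀ u v w → adj G u v ≡ true → adj G u w ≡ true → v ≢ w →
             col u v ≢ col u w
open EdgeColouring public

AtLeastColours : ∀ {G k} → EdgeColouring G k → Cycle G → ℕ → Set
AtLeastColours {k = k} c C t =
  Σ (List (Fin k)) λ cs → Unique cs × (t ≤ length cs) ×
    All (λ a → ∃[ i ] (col c (cv C i) (cv C (csuc i)) ≡ a)) cs

IsRAcyclic : (r : ℕ) → ∀ {G k} → EdgeColouring G k → Set
IsRAcyclic r {G} c = ∀ (C : Cycle G) → AtLeastColours c C (cycleLength C ⊓ r)

HasRAcyclicColouring : ℕ → Graph → ℕ → Set
HasRAcyclicColouring r G k = Σ (EdgeColouring G k) (IsRAcyclic r)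

GenAcyclicIndex≡ : ℕ → Graph → ℕ → Set
GenAcyclicIndex≡ r G k =
  HasRAcyclicColouring r G k × (∀ k' → HasRAcyclicColouring r G k' → k ≤ k')

-- Lower bounds: the edges at a vertex of maximum degree need Δ colours. A p-reduction never
-- destroys a cycle except by deleting the interior of an ear of length at least p, and a cycle
-- meeting the interior of an ear contains the whole ear (its internal vertices have degree 2);
-- hence every cycle of an (r+1)-path degenerate graph is longer than r + 1 and, if there is one,
-- an r-acyclic colouring needs r colours on it.
--
-- Upper bound, with k = Δ for forests and k = max(Δ, r) otherwise: undo the reductions one at a
-- time. A re-added vertex of degree at most 1 gets a colour missing at its neighbour, which exists
-- since that neighbour has degree < Δ ≤ k without it. A re-added ear of length L ≥ r + 1 is coloured
-- properly with end colours missing at its two endpoints and with its first min(r, k) edges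
-- rainbow; a new cycle runs through the whole ear and so sees r colours (forests have no cycles).

module Submission where

open import Defs renaming (sym to adj-sym)
open import Data.Nat as ℕ using (ℕ; zero; suc; pred; _+_; _∸_; _≤_; _<_; _⊔_; _⊓_; z≤n; s≤s; s≤s⁻¹; _≤?_; _<?_)
open import Data.Nat.Properties hiding (_≟_)
import Data.Bool as Bool
open import Data.Bool using (Bool; true; false; _∧_; if_then_else_)
open import Data.Bool.Properties using (∧-conicalˡ; ∧-conicalʳ; ∧-zeroʳ; ¬-not)
open import Data.Fin as Fin using (Fin; zero; suc; toℕ; fromℕ; fromℕ<; inject₁; punchOut; _≟_)
open import Data.Fin.Properties using (toℕ-injective; toℕ-fromℕ<; toℕ-fromℕ; toℕ-inject₁; toℕ<n; any?; all?; ¬∀⟶∃¬; injective⇒≤; punchIn-punchOut)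
import Data.Fin.Properties as Finₚ
open import Data.List using (List; []; _∷_; length; map; foldr; allFin; tabulate)
open import Data.List.Relation.Unary.All as All using (All; []; _∷_)
open import Data.List.Relation.Unary.Unique.Propositional using (Unique)
open import Data.List.Relation.Unary.AllPairs using ([]; _∷_)
import Data.List.Relation.Unary.Unique.Propositional.Properties as Unique
import Data.List.Relation.Unary.All.Properties as AllP
open import Data.List.Properties using (length-tabulate)
open import Data.List.Membership.Propositional using (_∈_)
open import Data.List.Membership.Propositional.Properties using (∈-allFin)
open import Data.List.Relation.Unary.Any using (here; there)
open import Data.Product using (Σ; ∃; ∃-syntax; _×_; _,_; proj₁; proj₂)
open import Data.Sum using (_⊎_; inj₁; inj₂; [_,_]′)
open import Data.Empty using (⊥; ⊥-elim)
open import Relation.Binary.PropositionalEquality using (_≡_; _≢_; refl; sym; trans; cong; cong₂; subst; subst₂)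
open import Relation.Nullary using (¬_; Dec; yes; no; does; contradiction)
import Relation.Nullary.Decidable as Dec
open import Relation.Nullary.Decidable using (dec-false; decidable-stable)
open import Data.Fin.Permutation as Perm using (Permutation; _⟨$⟩ʳ_; _⟨$⟩ˡ_; inverseˡ; insert)
open import Function using (_⇔_; _∘_; id)
open import Function.Bundles using (Equivalence)

-- Counting

erase : ∀ {m} → (Fin m → Bool) → Fin m → Fin m → Bool
erase Q z x = if does (x ≟ z) then false else Q x

erase-other : ∀ {m} (Q : Fin m → Bool) {z x} → x ≢ z → erase Q z x ≡ Q x
erase-other Q {z} {x} x≢z rewrite dec-false (x ≟ z) x≢z = refl

countTrue-erase : ∀ {m} (Q : Fin m → Bool) z → Q z ≡ true →
                  countTrue Q ≡ suc (countTrue (erase Q z))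
countTrue-erase Q zero Qz rewrite Qz = refl
countTrue-erase Q (suc z) Qz =
  trans (cong (q₀ +_) (countTrue-erase (Q ∘ suc) z Qz)) (+-suc q₀ _)
  where q₀ = if Q zero then 1 else 0

countTrue-injection : ∀ {m m'} (P : Fin m → Bool) (Q : Fin m' → Bool) (f : Fin m → Fin m') →
                      (∀ x → P x ≡ true → Q (f x) ≡ true) →
                      (∀ x y → P x ≡ true → P y ≡ true → f x ≡ f y → x ≡ y) →
                      countTrue P ≤ countTrue Q
countTrue-injection {zero} P Q f _ _ = z≤n
countTrue-injection {suc m} P Q f P⇒Qf inj with P zero in P₀
... | false = countTrue-injection (P ∘ suc) Q (f ∘ suc) (P⇒Qf ∘ suc)
                (λ x y Px Py e → Finₚ.suc-injective (inj (suc x) (suc y) Px Py e))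
... | true rewrite countTrue-erase Q (f zero) (P⇒Qf zero P₀) =
  s≤s (countTrue-injection (P ∘ suc) (erase Q (f zero)) (f ∘ suc)
         (λ x Px → trans (erase-other Q (λ e → Finₚ.0≢1+n (inj zero (suc x) P₀ Px (sym e)))) (P⇒Qf (suc x) Px))
         (λ x y Px Py e → Finₚ.suc-injective (inj (suc x) (suc y) Px Py e)))

countTrue-mono : ∀ {m} {P Q : Fin m → Bool} → (∀ x → P x ≡ true → Q x ≡ true) → countTrue P ≤ countTrue Q
countTrue-mono {P = P} {Q} P⇒Q = countTrue-injection P Q (λ x → x) P⇒Q (λ _ _ _ _ e → e)

countTrue-true : ∀ m → countTrue {m} (λ _ → true) ≡ m
countTrue-true zero = refl
countTrue-true (suc m) = cong suc (countTrue-true m)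

unique⇒length≤countTrue : ∀ {m} (Q : Fin m → Bool) (xs : List (Fin m)) → Unique xs →
                          All (λ x → Q x ≡ true) xs → length xs ≤ countTrue Q
unique⇒length≤countTrue Q [] _ _ = z≤n
unique⇒length≤countTrue Q (x ∷ xs) (x∉xs ∷ uniq) (Qx ∷ Qxs) rewrite countTrue-erase Q x Qx =
  s≤s (unique⇒length≤countTrue (erase Q x) xs uniq (All.zipWith erased (x∉xs , Qxs)))
  where
  erased : ∀ {y} → x ≢ y × Q y ≡ true → erase Q x y ≡ true
  erased (x≢y , Qy) = trans (erase-other Q (x≢y ∘ sym)) Qy

countTrue-mono-< : ∀ {m} {P Q : Fin m → Bool} z → (∀ x → P x ≡ true → Q x ≡ true) →
                   P z ≡ false → Q z ≡ true → countTrue P < countTrue Q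
countTrue-mono-< {P = P} {Q} z P⇒Q Pz Qz rewrite countTrue-erase Q z Qz =
  s≤s (countTrue-mono (λ x Px → trans (erase-other Q (λ { refl → contradiction (trans (sym Px) Pz) λ () })) (P⇒Q x Px)))

-- Degrees, induced subgraphs and cycles

≤-foldr-⊔ : ∀ {A : Set} (f : A → ℕ) {x} (xs : List A) → x ∈ xs → f x ≤ foldr _⊔_ 0 (map f xs)
≤-foldr-⊔ f (y ∷ ys) (here refl) = m≤m⊔n (f y) _
≤-foldr-⊔ f (y ∷ ys) (there x∈ys) = ≤-trans (≤-foldr-⊔ f ys x∈ys) (m≤n⊔m (f y) _)

foldr-⊔-lub : ∀ {A : Set} (f : A → ℕ) {k} (xs : List A) → (∀ x → f x ≤ k) → foldr _⊔_ 0 (map f xs) ≤ k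
foldr-⊔-lub f [] _ = z≤n
foldr-⊔-lub f (x ∷ xs) f≤k = ⊔-lub (f≤k x) (foldr-⊔-lub f xs f≤k)

deg≤maxDeg : (G : Graph) (v : Fin (n G)) → deg G v ≤ maxDeg G
deg≤maxDeg G v = ≤-foldr-⊔ (deg G) (allFin (n G)) (∈-allFin v)

maxDeg-lub : (G : Graph) {k : ℕ} → (∀ v → deg G v ≤ k) → maxDeg G ≤ k
maxDeg-lub G deg≤k = foldr-⊔-lub (deg G) (allFin (n G)) deg≤k

module _ (G : Graph) where

  adjIn : VSet G → Fin (n G) → Fin (n G) → Bool
  adjIn S u w = adj G u w ∧ S w

  EdgeIn : VSet G → Fin (n G) → Fin (n G) → Set
  EdgeIn S u v = (adj G u v ≡ true) × (S u ≡ true) × (S v ≡ true)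

  CycleIn : VSet G → Cycle G → Set
  CycleIn S C = ∀ i → S (cv C i) ≡ true

module _ {G : Graph} {S : VSet G} where

  EdgeIn⇒adjIn : ∀ {u v} → EdgeIn G S u v → adjIn G S u v ≡ true
  EdgeIn⇒adjIn (uv , _ , Sv) = cong₂ _∧_ uv Sv

  EdgeIn-sym : ∀ {u v} → EdgeIn G S u v → EdgeIn G S v u
  EdgeIn-sym {u} {v} (uv , Su , Sv) = trans (adj-sym G v u) uv , Sv , Su

  adjIn-sym : ∀ {u v} → S u ≡ true → adjIn G S u v ≡ true → adjIn G S v u ≡ true
  adjIn-sym {u} {v} Su uv = cong₂ _∧_ (trans (adj-sym G v u) (∧-conicalˡ _ _ uv)) Su

  degIn≤deg : ∀ u → degIn G S u ≤ deg G u
  degIn≤deg u = countTrue-mono {P = adjIn G S u} {Q = λ w → adj G u w ∧ true} (λ w uw → cong (_∧ true) (∧-conicalˡ _ _ uw))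

  2≤degIn : ∀ {w a b} → a ≢ b → adjIn G S w a ≡ true → adjIn G S w b ≡ true → 2 ≤ degIn G S w
  2≤degIn a≢b wa wb = unique⇒length≤countTrue _ (_ ∷ _ ∷ []) ((a≢b ∷ []) ∷ [] ∷ []) (wa ∷ wb ∷ [])

  degIn≡2⇒neighbours : ∀ {w a b c} → degIn G S w ≡ 2 → a ≢ b →
                       adjIn G S w a ≡ true → adjIn G S w b ≡ true → adjIn G S w c ≡ true →
                       c ≡ a ⊎ c ≡ b
  degIn≡2⇒neighbours {w} {a} {b} {c} deg≡2 a≢b wa wb wc with c ≟ a | c ≟ b
  ... | yes c≡a | _ = inj₁ c≡a
  ... | no _ | yes c≡b = inj₂ c≡b
  ... | no c≢a | no c≢b = contradiction (subst (3 ≤_) deg≡2 three≤deg) (λ { (s≤s (s≤s ())) })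
    where
    three≤deg : 3 ≤ degIn G S w
    three≤deg = unique⇒length≤countTrue _ (_ ∷ _ ∷ _ ∷ [])
                  ((a≢b ∷ (c≢a ∘ sym) ∷ []) ∷ ((c≢b ∘ sym) ∷ []) ∷ [] ∷ []) (wa ∷ wb ∷ wc ∷ [])

csuc-last : ∀ {k} (i : Fin (suc k)) → toℕ i ≡ k → csuc i ≡ zero
csuc-last {zero} zero _ = refl
csuc-last {suc k} (suc i) i≡k with csuc {k} i | csuc-last {k} i (suc-injective i≡k)
... | zero | _ = refl

toℕ-csuc : ∀ {k} (i : Fin (suc k)) → toℕ i < k → toℕ (csuc i) ≡ suc (toℕ i)
toℕ-csuc {suc k} zero _ = refl
toℕ-csuc {suc k} (suc i) (s≤s i<k) with csuc {k} i | toℕ-csuc {k} i i<k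
... | suc _ | e = cong suc e

-- Cycles have length at least 3, so the successor of p is not its predecessor.
cyclic-predecessor : ∀ j (p : Fin (3 + j)) → ∃[ q ] (csuc q ≡ p × csuc p ≢ q)
cyclic-predecessor j zero = last , csuc-last last (toℕ-fromℕ (2 + j)) , 1≢last
  where
  last = fromℕ (2 + j)
  1≢last : suc zero ≢ last
  1≢last e = contradiction (trans (cong toℕ e) (toℕ-fromℕ (2 + j))) (λ ())
cyclic-predecessor j (suc p) = inject₁ p , toℕ-injective forward , not-back
  where
  forward : toℕ (csuc (inject₁ p)) ≡ suc (toℕ p)
  forward = trans (toℕ-csuc (inject₁ p) (subst (_< 2 + j) (sym (toℕ-inject₁ p)) (toℕ<n p)))
                  (cong suc (toℕ-inject₁ p))
  not-back : csuc (suc p) ≢ inject₁ p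
  not-back e with suc (toℕ p) ℕ.≟ 2 + j
  ... | yes isLast = contradiction (trans (cong suc p≡0) isLast) (λ ())
    where
    p≡0 : 0 ≡ toℕ p
    p≡0 = trans (cong toℕ (trans (sym (csuc-last (suc p) isLast)) e)) (toℕ-inject₁ p)
  ... | no notLast = contradiction (trans (sym (toℕ-csuc (suc p) (≤∧≢⇒< (s≤s⁻¹ (toℕ<n (suc p))) notLast)))
                                          (trans (cong toℕ e) (toℕ-inject₁ p)))
                                   (λ 2+p≡p → <-irrefl (sym 2+p≡p) (<-trans (n<1+n _) (n<1+n _)))

module _ {G : Graph} {S : VSet G} (C : Cycle G) (C⊆S : CycleIn G S C) where

  cycle-neighbours : ∀ p → ∃[ q ] (csuc q ≡ p × adjIn G S (cv C p) (cv C (csuc p)) ≡ true ×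
                                  adjIn G S (cv C p) (cv C q) ≡ true × cv C (csuc p) ≢ cv C q)
  cycle-neighbours p with cyclic-predecessor (j C) p
  ... | q , q→p , p↛q = q , q→p , cong₂ _∧_ (cadj C p) (C⊆S (csuc p)) ,
                        adjIn-sym {G = G} {S} (C⊆S q) (subst (λ z → adjIn G S (cv C q) (cv C z) ≡ true) q→p
                                                  (cong₂ _∧_ (cadj C q) (C⊆S (csuc q)))) ,
                        p↛q ∘ cinj C

  lowDegree-off-cycle : ∀ {v} → degIn G S v ≤ 1 → ∀ p → cv C p ≢ v
  lowDegree-off-cycle deg≤1 p refl with cycle-neighbours p
  ... | _ , _ , n₁ , n₂ , n₁≢n₂ =
    contradiction (≤-trans (2≤degIn {G = G} {S} n₁≢n₂ n₁ n₂) deg≤1) (λ { (s≤s ()) })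

-- Ears

-- A strict ear X 0, …, X L of G[S] with S' = S minus its internal vertices, as in delEar.
-- Vertices are indexed by ℕ rather than Fin (suc L); X t is junk for t > L.
record EarRemoval (G : Graph) (S S' : VSet G) : Set where
  field
    L          : ℕ
    X          : ℕ → Fin (n G)
    X-inj      : ∀ {t t'} → t ≤ L → t' ≤ L → X t ≡ X t' → t ≡ t'
    X∈S        : ∀ t → S (X t) ≡ true
    X-adj      : ∀ t → t < L → adj G (X t) (X (suc t)) ≡ true
    X-deg2     : ∀ t → 0 < t → t < L → degIn G S (X t) ≡ 2
    X∉S'       : ∀ t → 0 < t → t < L → S' (X t) ≡ false
    S'⊆S       : ∀ u → S' u ≡ true → S u ≡ true
    S⊆S'∪ear   : ∀ u → S u ≡ true → S' u ≡ true ⊎ ∃[ t ] (0 < t × t < L × X t ≡ u)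

clamp : ∀ L → ℕ → Fin (suc L)
clamp L t with t ≤? L
... | yes t≤L = fromℕ< (s≤s t≤L)
... | no _ = zero

toℕ-clamp : ∀ {L t} → t ≤ L → toℕ (clamp L t) ≡ t
toℕ-clamp {L} {t} t≤L with t ≤? L
... | yes p = toℕ-fromℕ< (s≤s p)
... | no t≰L = contradiction t≤L t≰L

module _ {G : Graph} {S S' : VSet G} (E : StrictEar G S)
         (S'-spec : ∀ u → (S' u ≡ true) ⇔ ((S u ≡ true) × ¬ (∃[ i ] (Internal i × (vx E i ≡ u))))) where

  private
    ℓ = len E

    internal⇒bounds : ∀ {i} → Internal {ℓ} i → 0 < toℕ i × toℕ i < ℓ
    internal⇒bounds {i} (i≢0 , i≢ℓ) =
      n≢0⇒n>0 (i≢0 ∘ toℕ-injective) ,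
      ≤∧≢⇒< (s≤s⁻¹ (toℕ<n i)) (λ e → i≢ℓ (toℕ-injective (trans e (sym (toℕ-fromℕ ℓ)))))

    bounds⇒internal : ∀ {t} → 0 < t → t < ℓ → Internal {ℓ} (clamp ℓ t)
    bounds⇒internal {t} 0<t t<ℓ =
      (λ e → <-irrefl (sym (trans (sym (toℕ-clamp (<⇒≤ t<ℓ))) (cong toℕ e))) 0<t) ,
      (λ e → <-irrefl (trans (sym (toℕ-clamp (<⇒≤ t<ℓ))) (trans (cong toℕ e) (toℕ-fromℕ ℓ))) t<ℓ)

    internal? : ∀ u → Dec (∃[ i ] (Internal {ℓ} i × (vx E i ≡ u)))
    internal? u = any? (λ i → ((Dec.¬? (i ≟ zero) Dec.×-dec Dec.¬? (i ≟ fromℕ ℓ)) Dec.×-dec (vx E i ≟ u)))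

  earRemoval : EarRemoval G S S'
  earRemoval = record
    { L = ℓ
    ; X = vx E ∘ clamp ℓ
    ; X-inj = λ t≤ℓ t'≤ℓ e → trans (sym (toℕ-clamp t≤ℓ)) (trans (cong toℕ (inj E e)) (toℕ-clamp t'≤ℓ))
    ; X∈S = inS E ∘ clamp ℓ
    ; X-adj = λ t t<ℓ → subst₂ (λ a b → adj G (vx E a) (vx E b) ≡ true)
                (toℕ-injective (trans (toℕ-inject₁ (fromℕ< t<ℓ))
                                      (trans (toℕ-fromℕ< t<ℓ) (sym (toℕ-clamp (<⇒≤ t<ℓ))))))
                (toℕ-injective (trans (cong suc (toℕ-fromℕ< t<ℓ)) (sym (toℕ-clamp t<ℓ))))
                (path E (fromℕ< t<ℓ))
    ; X-deg2 = λ t 0<t t<ℓ → internal E (clamp ℓ t) (bounds⇒internal 0<t t<ℓ)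
    ; X∉S' = λ t 0<t t<ℓ → ¬-not (λ S'x → proj₂ (Equivalence.to (S'-spec _) S'x)
                                                   (clamp ℓ t , bounds⇒internal 0<t t<ℓ , refl))
    ; S'⊆S = λ u S'u → proj₁ (Equivalence.to (S'-spec u) S'u)
    ; S⊆S'∪ear = S⊆S'∪ear
    }
    where
    S⊆S'∪ear : ∀ u → S u ≡ true → S' u ≡ true ⊎ ∃[ t ] (0 < t × t < ℓ × vx E (clamp ℓ t) ≡ u)
    S⊆S'∪ear u Su with internal? u
    ... | no ¬internal = inj₁ (Equivalence.from (S'-spec u) (Su , ¬internal))
    ... | yes (i , i-int , e) =
      inj₂ (toℕ i , proj₁ (internal⇒bounds i-int) , proj₂ (internal⇒bounds i-int) ,
            trans (cong (vx E) (toℕ-injective (toℕ-clamp (s≤s⁻¹ (toℕ<n i))))) e)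

OnCycle : ∀ {G} → Cycle G → Fin (n G) → Set
OnCycle C v = ∃[ p ] (cv C p ≡ v)

EdgeOnCycle : ∀ {G} → Cycle G → Fin (n G) → Fin (n G) → Set
EdgeOnCycle C u v = ∃[ i ] ((cv C i ≡ u × cv C (csuc i) ≡ v) ⊎ (cv C i ≡ v × cv C (csuc i) ≡ u))

EdgeOnCycle-sym : ∀ {G} (C : Cycle G) {u v} → EdgeOnCycle C u v → EdgeOnCycle C v u
EdgeOnCycle-sym C (i , inj₁ e) = i , inj₂ e
EdgeOnCycle-sym C (i , inj₂ e) = i , inj₁ e

EdgeOnCycle⇒OnCycleʳ : ∀ {G} (C : Cycle G) {u v} → EdgeOnCycle C u v → OnCycle C v
EdgeOnCycle⇒OnCycleʳ C (i , inj₁ (_ , e)) = csuc i , e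
EdgeOnCycle⇒OnCycleʳ C (i , inj₂ (e , _)) = i , e

≡-either-of-two : ∀ {A : Set} {a b x y w : A} → x ≢ y → x ≡ a ⊎ x ≡ b → y ≡ a ⊎ y ≡ b →
                  w ≡ a ⊎ w ≡ b → w ≡ x ⊎ w ≡ y
≡-either-of-two x≢y (inj₁ refl) (inj₁ refl) _ = contradiction refl x≢y
≡-either-of-two x≢y (inj₂ refl) (inj₂ refl) _ = contradiction refl x≢y
≡-either-of-two _ (inj₁ refl) (inj₂ refl) w = w
≡-either-of-two _ (inj₂ refl) (inj₁ refl) (inj₁ w≡a) = inj₂ w≡a
≡-either-of-two _ (inj₂ refl) (inj₁ refl) (inj₂ w≡b) = inj₁ w≡b

spread-on-interval : ∀ {P : ℕ → Set} {L m₀} → 0 < m₀ → m₀ < L → P m₀ →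
                     (∀ s → suc s < L → P (suc s) → P s × P (suc (suc s))) →
                     ∀ t → t ≤ L → P t
spread-on-interval {P} {L} {suc m} (s≤s z≤n) m₀<L Pm₀ spread t t≤L with t ≤? m
... | yes t≤m = subst P (m∸[m∸n]≡n t≤m) (down (m ∸ t) (m∸n≤m m t))
  where
  down : ∀ k → k ≤ m → P (m ∸ k)
  down zero _ = proj₁ (spread m m₀<L Pm₀)
  down (suc k) k<m = proj₁ (spread (m ∸ suc k) (≤-<-trans (s≤s (m∸n≤m m (suc k))) m₀<L)
                                   (subst P (+-∸-assoc 1 k<m) (down k (<⇒≤ k<m))))
... | no t≰m = subst P t≡ (up (t ∸ suc m) (subst (_≤ L) (sym t≡) t≤L))
  where
  t≡ : suc (t ∸ suc m + m) ≡ t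
  t≡ = trans (sym (+-suc (t ∸ suc m) m)) (m∸n+n≡m (≰⇒> t≰m))
  up : ∀ k → suc (k + m) ≤ L → P (suc (k + m))
  up zero _ = Pm₀
  up (suc k) bound = proj₂ (spread (k + m) bound (up k (<⇒≤ bound)))

module _ {G : Graph} {S S' : VSet G} (R : EarRemoval G S S') where
  open EarRemoval R

  ear-adjIn : ∀ {t} → t < L → adjIn G S (X t) (X (suc t)) ≡ true
  ear-adjIn {t} t<L = cong₂ _∧_ (X-adj t t<L) (X∈S (suc t))

  ear-adjIn-back : ∀ {t} → t < L → adjIn G S (X (suc t)) (X t) ≡ true
  ear-adjIn-back {t} t<L = adjIn-sym {G = G} {S} (X∈S t) (ear-adjIn t<L)

ear-interior-neighbours : ∀ {G S S'} (R : EarRemoval G S S') → let open EarRemoval R in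
                          ∀ {s w} → suc s < L → adjIn G S (X (suc s)) w ≡ true → w ≡ X s ⊎ w ≡ X (suc (suc s))
ear-interior-neighbours {G} {S} R {s} s<L =
  degIn≡2⇒neighbours {G = G} {S} (X-deg2 (suc s) (s≤s z≤n) s<L) prev≢next
    (ear-adjIn-back R (<⇒≤ s<L)) (ear-adjIn R s<L)
  where
  open EarRemoval R
  prev≢next : X s ≢ X (suc (suc s))
  prev≢next e = <-irrefl (X-inj (≤-trans (n≤1+n s) (<⇒≤ s<L)) s<L e) (<-trans (n<1+n s) (n<1+n (suc s)))

module _ {G : Graph} {S S' : VSet G} (R : EarRemoval G S S') (C : Cycle G) (C⊆S : CycleIn G S C) where
  open EarRemoval R

  ear-interior-edges-on-cycle : ∀ s → suc s < L → OnCycle C (X (suc s)) →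
                                EdgeOnCycle C (X (suc s)) (X s) × EdgeOnCycle C (X (suc s)) (X (suc (suc s)))
  ear-interior-edges-on-cycle s s<L (p , p↦x) with cycle-neighbours {S = S} C C⊆S p
  ... | q , q→p , adj-next , adj-prev , next≢prev =
    onCycle (inj₁ refl) , onCycle (inj₂ refl)
    where
    ear-neighbour : ∀ {w} → adjIn G S (cv C p) w ≡ true → w ≡ X s ⊎ w ≡ X (suc (suc s))
    ear-neighbour {w} = ear-interior-neighbours R s<L ∘ subst (λ z → adjIn G S z w ≡ true) p↦x
    onCycle : ∀ {w} → w ≡ X s ⊎ w ≡ X (suc (suc s)) → EdgeOnCycle C (X (suc s)) w
    onCycle w-ear with ≡-either-of-two next≢prev (ear-neighbour adj-next) (ear-neighbour adj-prev) w-ear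
    ... | inj₁ w≡next = p , inj₁ (p↦x , sym w≡next)
    ... | inj₂ w≡prev = q , inj₂ (sym w≡prev , trans (cong (cv C) q→p) p↦x)

  module _ {m₀} (0<m₀ : 0 < m₀) (m₀<L : m₀ < L) (m₀-on : OnCycle C (X m₀)) where

    ear-on-cycle : ∀ t → t ≤ L → OnCycle C (X t)
    ear-on-cycle = spread-on-interval 0<m₀ m₀<L m₀-on λ s s<L on →
      let edges = ear-interior-edges-on-cycle s s<L on
      in EdgeOnCycle⇒OnCycleʳ C (proj₁ edges) , EdgeOnCycle⇒OnCycleʳ C (proj₂ edges)

    ear-edges-on-cycle : ∀ t → t < L → EdgeOnCycle C (X t) (X (suc t))
    ear-edges-on-cycle zero _ =
      EdgeOnCycle-sym C (proj₁ (ear-interior-edges-on-cycle 0 1<L (ear-on-cycle 1 (<⇒≤ 1<L))))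
      where
      1<L : 1 < L
      1<L = ≤-<-trans 0<m₀ m₀<L
    ear-edges-on-cycle (suc s) s<L =
      proj₂ (ear-interior-edges-on-cycle s s<L (ear-on-cycle (suc s) (<⇒≤ s<L)))

    L<cycleLength : L < cycleLength C
    L<cycleLength = injective⇒≤ {f = position} position-injective
      where
      position : Fin (suc L) → Fin (cycleLength C)
      position t = proj₁ (ear-on-cycle (toℕ t) (s≤s⁻¹ (toℕ<n t)))
      position-injective : ∀ {t t'} → position t ≡ position t' → t ≡ t'
      position-injective {t} {t'} e = toℕ-injective (X-inj (s≤s⁻¹ (toℕ<n t)) (s≤s⁻¹ (toℕ<n t'))
        (trans (sym (proj₂ (ear-on-cycle (toℕ t) _))) (trans (cong (cv C) e) (proj₂ (ear-on-cycle (toℕ t') _)))))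

  cycle-meets-ear : ∀ i → S' (cv C i) ≢ true → ∃[ m₀ ] (0 < m₀ × m₀ < L × OnCycle C (X m₀))
  cycle-meets-ear i i∉S' with S⊆S'∪ear (cv C i) (C⊆S i)
  ... | inj₁ i∈S' = contradiction i∈S' i∉S'
  ... | inj₂ (m₀ , 0<m₀ , m₀<L , m₀↦i) = m₀ , 0<m₀ , m₀<L , i , sym m₀↦i

cycleIn-or-leaves : ∀ {G} (S : VSet G) (C : Cycle G) → CycleIn G S C ⊎ ∃[ i ] (S (cv C i) ≢ true)
cycleIn-or-leaves S C with all? (λ i → S (cv C i) Bool.≟ true)
... | yes C⊆S = inj₁ C⊆S
... | no C⊈S = inj₂ (¬∀⟶∃¬ _ _ (λ i → S (cv C i) Bool.≟ true) C⊈S)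

Reduces⇒long-cycles : ∀ {p G S} → Reduces p G S → (C : Cycle G) → CycleIn G S C → p < cycleLength C
Reduces⇒long-cycles (done S≡∅) C C⊆S = contradiction (trans (sym (C⊆S zero)) (S≡∅ _)) (λ ())
Reduces⇒long-cycles {S = S} (step (delVertex v _ deg≤1 S'-spec) red) C C⊆S =
  Reduces⇒long-cycles red C λ i →
    Equivalence.from (S'-spec (cv C i)) (C⊆S i , lowDegree-off-cycle {S = S} C C⊆S deg≤1 i)
Reduces⇒long-cycles {S = S} (step {S' = S'} (delEar E p≤ℓ S'-spec) red) C C⊆S with cycleIn-or-leaves S' C
... | inj₁ C⊆S' = Reduces⇒long-cycles red C C⊆S'
... | inj₂ (i , i∉S') with cycle-meets-ear (earRemoval E S'-spec) C C⊆S i i∉S'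
...   | _ , 0<m₀ , m₀<L , on = ≤-<-trans p≤ℓ (L<cycleLength (earRemoval E S'-spec) C C⊆S 0<m₀ m₀<L on)

-- Lower bounds

maxDeg≤colours : ∀ {G k} → EdgeColouring G k → maxDeg G ≤ k
maxDeg≤colours {G} {k} c = maxDeg-lub G λ v →
  subst (deg G v ≤_) (countTrue-true k)
    (countTrue-injection (λ u → adj G v u ∧ true) (λ _ → true) (col c v) (λ _ _ → refl) (colour-injective v))
  where
  colour-injective : ∀ v x y → adj G v x ∧ true ≡ true → adj G v y ∧ true ≡ true → col c v x ≡ col c v y → x ≡ y
  colour-injective v x y vx vy same with x ≟ y
  ... | yes x≡y = x≡y
  ... | no x≢y = contradiction same (proper c v x y (∧-conicalˡ _ _ vx) (∧-conicalˡ _ _ vy) x≢y)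

r≤colours : ∀ {r G k} (c : EdgeColouring G k) → IsRAcyclic r c → (C : Cycle G) → r ≤ cycleLength C → r ≤ k
r≤colours {r} {k = k} c acyclic C r≤|C| with acyclic C
... | cs , unique , |C|⊓r≤ , _ =
  ≤-trans (subst (_≤ length cs) (m≥n⇒m⊓n≡n r≤|C|) |C|⊓r≤)
          (subst (length cs ≤_) (countTrue-true k)
                 (unique⇒length≤countTrue (λ _ → true) cs unique (All.universal (λ _ → refl) cs)))

-- Extending colourings along a reduction

-- AtLeastColours for a colour function that is not yet known to be a proper colouring.
SeesColours : ∀ {G k} → (Fin (n G) → Fin (n G) → Fin k) → Cycle G → ℕ → Set
SeesColours {k = k} c C t =
  Σ (List (Fin k)) λ cs → Unique cs × (t ≤ length cs) × All (λ a → ∃[ i ] (c (cv C i) (cv C (csuc i)) ≡ a)) cs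

SeesColours-cong : ∀ {G k} {c c' : Fin (n G) → Fin (n G) → Fin k} (C : Cycle G) {t} →
                   (∀ i → c (cv C i) (cv C (csuc i)) ≡ c' (cv C i) (cv C (csuc i))) →
                   SeesColours c C t → SeesColours c' C t
SeesColours-cong C c≗c' (cs , unique , t≤ , seen) =
  cs , unique , t≤ , All.map (λ { (i , e) → i , trans (sym (c≗c' i)) e }) seen

record RAcyclicOn (r : ℕ) (G : Graph) (k : ℕ) (S : VSet G) : Set where
  field
    colour         : Fin (n G) → Fin (n G) → Fin k
    colour-sym     : ∀ {u v} → EdgeIn G S u v → colour u v ≡ colour v u
    colour-proper  : ∀ {u v w} → EdgeIn G S u v → EdgeIn G S u w → v ≢ w → colour u v ≢ colour u w
    colour-acyclic : ∀ C → CycleIn G S C → SeesColours colour C (cycleLength C ⊓ r)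
open RAcyclicOn

RAcyclicOn-∅ : ∀ {r G k} {S : VSet G} → 0 < k → (∀ u → S u ≡ false) → RAcyclicOn r G k S
RAcyclicOn-∅ {S = S} 0<k S≡∅ = record
  { colour = λ _ _ → fromℕ< 0<k
  ; colour-sym = λ { {u} (_ , Su , _) → ∅-elim Su }
  ; colour-proper = λ { {u} (_ , Su , _) _ _ → ∅-elim Su }
  ; colour-acyclic = λ C C⊆S → ∅-elim (C⊆S zero)
  }
  where
  ∅-elim : ∀ {A : Set} {u} → S u ≡ true → A
  ∅-elim {u = u} Su = contradiction (trans (sym Su) (S≡∅ u)) (λ ())

RAcyclicOn-full⇒colouring : ∀ {r G k} → RAcyclicOn r G k (full G) → HasRAcyclicColouring r G k
RAcyclicOn-full⇒colouring g =
  record { col = colour g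
         ; colSym = λ u v uv → colour-sym g (uv , refl , refl)
         ; proper = λ u v w uv uw → colour-proper g (uv , refl , refl) (uw , refl , refl) } ,
  λ C → colour-acyclic g C (λ _ → refl)

colourUsed? : ∀ {k} (G : Graph) (S : VSet G) (c : Fin (n G) → Fin (n G) → Fin k) u a →
              Dec (∃[ w ] (adjIn G S u w ≡ true × c u w ≡ a))
colourUsed? G S c u a = any? λ w → (adjIn G S u w Bool.≟ true) Dec.×-dec (c u w ≟ a)

missing-colour : ∀ {k} (G : Graph) (S : VSet G) (c : Fin (n G) → Fin (n G) → Fin k) u → degIn G S u < k →
                 ∃[ a ] (∀ w → adjIn G S u w ≡ true → c u w ≢ a)
missing-colour {k} G S c u deg<k with all? (colourUsed? G S c u)
... | yes all-used = contradiction (subst (_≤ degIn G S u) (countTrue-true k) k≤deg) (<⇒≱ deg<k)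
  where
  k≤deg : countTrue {k} (λ _ → true) ≤ degIn G S u
  k≤deg = countTrue-injection (λ _ → true) (adjIn G S u) (proj₁ ∘ all-used) (λ a _ → proj₁ (proj₂ (all-used a)))
            (λ a b _ _ e → trans (sym (proj₂ (proj₂ (all-used a)))) (trans (cong (c u) e) (proj₂ (proj₂ (all-used b)))))
... | no ¬all-used with ¬∀⟶∃¬ _ _ (colourUsed? G S c u) ¬all-used
...   | a , unused = a , λ w uw cuw≡a → unused (w , uw , cuw≡a)

missing-colour-after-removal : ∀ {G k} {S S' : VSet G} (c : Fin (n G) → Fin (n G) → Fin k) →
                               maxDeg G ≤ k → (∀ w → S' w ≡ true → S w ≡ true) → ∀ {u z} →
                               adjIn G S u z ≡ true → S' z ≡ false →
                               ∃[ a ] (∀ w → adjIn G S' u w ≡ true → c u w ≢ a)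
missing-colour-after-removal {G} {S = S} {S'} c Δ≤k S'⊆S {u} {z} uz S'z≡false =
  missing-colour G S' c u (<-≤-trans fewer (≤-trans (degIn≤deg {G = G} {S} u) (≤-trans (deg≤maxDeg G u) Δ≤k)))
  where
  fewer : degIn G S' u < degIn G S u
  fewer = countTrue-mono-< z (λ w uw → cong₂ _∧_ (∧-conicalˡ _ _ uw) (S'⊆S w (∧-conicalʳ _ _ uw)))
                           (trans (cong (adj G u z ∧_) S'z≡false) (∧-zeroʳ (adj G u z))) uz

module ExtendOverVertex {r G k} (Δ≤k : maxDeg G ≤ k) (0<k : 0 < k) {S S' : VSet G} (g : RAcyclicOn r G k S')
                        {v} (Sv : S v ≡ true) (deg≤1 : degIn G S v ≤ 1)
                        (S'-spec : ∀ u → (S' u ≡ true) ⇔ ((S u ≡ true) × (u ≢ v))) where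

  private
    c = colour g

    S'⊆S : ∀ w → S' w ≡ true → S w ≡ true
    S'⊆S w = proj₁ ∘ Equivalence.to (S'-spec w)

    v∉S' : S' v ≡ false
    v∉S' = ¬-not (λ S'v → proj₂ (Equivalence.to (S'-spec v) S'v) refl)

    EdgeIn-S' : ∀ {x y} → EdgeIn G S x y → x ≢ v → y ≢ v → EdgeIn G S' x y
    EdgeIn-S' (xy , Sx , Sy) x≢v y≢v =
      xy , Equivalence.from (S'-spec _) (Sx , x≢v) , Equivalence.from (S'-spec _) (Sy , y≢v)

    neighbour-unique : ∀ {w w'} → adjIn G S v w ≡ true → adjIn G S v w' ≡ true → w ≡ w'
    neighbour-unique {w} {w'} vw vw' with w ≟ w'
    ... | yes w≡w' = w≡w'
    ... | no w≢w' = contradiction (≤-trans (2≤degIn {G = G} {S} w≢w' vw vw') deg≤1) (λ { (s≤s ()) })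

    MissingAtNeighbour : Fin k → Set
    MissingAtNeighbour a = ∀ x → adjIn G S v x ≡ true → ∀ w → adjIn G S' x w ≡ true → c x w ≢ a

    spare : ∃ MissingAtNeighbour
    spare with any? (λ u → adjIn G S v u Bool.≟ true)
    ... | no isolated = fromℕ< 0<k , λ x vx → contradiction (x , vx) isolated
    ... | yes (u , vu) with missing-colour-after-removal {G = G} {S = S} c Δ≤k S'⊆S (adjIn-sym {G = G} {S} Sv vu) v∉S'
    ...   | a , missing = a , λ x vx → subst (λ z → ∀ w → adjIn G S' z w ≡ true → c z w ≢ a)
                                             (neighbour-unique vu vx) missing

    a = proj₁ spare

  extended : Fin (n G) → Fin (n G) → Fin k
  extended x y with x ≟ v | y ≟ v
  ... | no _ | no _ = c x y
  ... | _ | _ = a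

  private
    extended-at-v : ∀ x y → x ≡ v ⊎ y ≡ v → extended x y ≡ a
    extended-at-v x y at-v with x ≟ v | y ≟ v | at-v
    ... | yes _ | _ | _ = refl
    ... | no _ | yes _ | _ = refl
    ... | no x≢v | no _ | inj₁ x≡v = contradiction x≡v x≢v
    ... | no _ | no y≢v | inj₂ y≡v = contradiction y≡v y≢v

    extended-off-v : ∀ {x y} → x ≢ v → y ≢ v → extended x y ≡ c x y
    extended-off-v {x} {y} x≢v y≢v with x ≟ v | y ≟ v
    ... | yes x≡v | _ = contradiction x≡v x≢v
    ... | no _ | yes y≡v = contradiction y≡v y≢v
    ... | no _ | no _ = refl

    extended-sym : ∀ {x y} → EdgeIn G S x y → extended x y ≡ extended y x
    extended-sym {x} {y} xy = by-cases (x ≟ v) (y ≟ v)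
      where
      by-cases : Dec (x ≡ v) → Dec (y ≡ v) → extended x y ≡ extended y x
      by-cases (yes x≡v) _ = trans (extended-at-v x y (inj₁ x≡v)) (sym (extended-at-v y x (inj₂ x≡v)))
      by-cases (no _) (yes y≡v) = trans (extended-at-v x y (inj₂ y≡v)) (sym (extended-at-v y x (inj₁ y≡v)))
      by-cases (no x≢v) (no y≢v) =
        trans (extended-off-v x≢v y≢v) (trans (colour-sym g (EdgeIn-S' xy x≢v y≢v)) (sym (extended-off-v y≢v x≢v)))

    spare-vs-old : ∀ {x y} → EdgeIn G S x v → EdgeIn G S x y → x ≢ v → y ≢ v → extended x v ≢ extended x y
    spare-vs-old {x} xv xy x≢v y≢v e =
      proj₂ spare _ (EdgeIn⇒adjIn {G = G} {S} (EdgeIn-sym {G = G} {S} xv)) _ (EdgeIn⇒adjIn {G = G} {S'} (EdgeIn-S' xy x≢v y≢v))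
        (trans (sym (extended-off-v x≢v y≢v)) (trans (sym e) (extended-at-v x v (inj₂ refl))))

    extended-proper : ∀ {x y₁ y₂} → EdgeIn G S x y₁ → EdgeIn G S x y₂ → y₁ ≢ y₂ → extended x y₁ ≢ extended x y₂
    extended-proper {x} {y₁} {y₂} xy₁ xy₂ y₁≢y₂ = by-cases (x ≟ v) (y₁ ≟ v) (y₂ ≟ v)
      where
      by-cases : Dec (x ≡ v) → Dec (y₁ ≡ v) → Dec (y₂ ≡ v) → extended x y₁ ≢ extended x y₂
      by-cases (yes refl) _ _ = λ _ → y₁≢y₂ (neighbour-unique (EdgeIn⇒adjIn {G = G} {S} xy₁) (EdgeIn⇒adjIn {G = G} {S} xy₂))
      by-cases (no _) (yes refl) (yes refl) = λ _ → y₁≢y₂ refl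
      by-cases (no x≢v) (yes refl) (no y₂≢v) = spare-vs-old xy₁ xy₂ x≢v y₂≢v
      by-cases (no x≢v) (no y₁≢v) (yes refl) = spare-vs-old xy₂ xy₁ x≢v y₁≢v ∘ sym
      by-cases (no x≢v) (no y₁≢v) (no y₂≢v) e =
        colour-proper g (EdgeIn-S' xy₁ x≢v y₁≢v) (EdgeIn-S' xy₂ x≢v y₂≢v) y₁≢y₂
          (trans (sym (extended-off-v x≢v y₁≢v)) (trans e (extended-off-v x≢v y₂≢v)))

    extended-acyclic : ∀ C → CycleIn G S C → SeesColours extended C (cycleLength C ⊓ r)
    extended-acyclic C C⊆S =
      SeesColours-cong {c = c} {extended} C (λ i → sym (extended-off-v (off i) (off (csuc i))))
        (colour-acyclic g C λ i → Equivalence.from (S'-spec (cv C i)) (C⊆S i , off i))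
      where
      off = lowDegree-off-cycle {S = S} C C⊆S deg≤1

  colouring : RAcyclicOn r G k S
  colouring = record { colour = extended ; colour-sym = extended-sym ; colour-proper = extended-proper
                     ; colour-acyclic = extended-acyclic }

alternate : ∀ {A : Set} → A → A → ℕ → A
alternate b c zero = b
alternate b c (suc zero) = c
alternate b c (suc (suc d)) = alternate b c d

alternate-≢ : ∀ {A : Set} {b c : A} → b ≢ c → ∀ d → alternate b c d ≢ alternate b c (suc d)
alternate-≢ b≢c zero = b≢c
alternate-≢ b≢c (suc zero) = b≢c ∘ sym
alternate-≢ b≢c (suc (suc d)) = alternate-≢ b≢c d

alternate-∈ : ∀ {A : Set} (b c : A) d → alternate b c d ≡ b ⊎ alternate b c d ≡ c
alternate-∈ b c zero = inj₁ refl
alternate-∈ b c (suc zero) = inj₂ refl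
alternate-∈ b c (suc (suc d)) = alternate-∈ b c d

avoid-two : ∀ {k} → 3 ≤ k → (p q : Fin k) → ∃[ c ] (c ≢ p × c ≢ q)
avoid-two (s≤s (s≤s (s≤s _))) p q with avoids? zero | avoids? (suc zero) | avoids? (suc (suc zero))
  where
  avoids? : ∀ c → (c ≢ p × c ≢ q) ⊎ (c ≡ p ⊎ c ≡ q)
  avoids? c with c ≟ p | c ≟ q
  ... | yes c≡p | _ = inj₂ (inj₁ c≡p)
  ... | no _ | yes c≡q = inj₂ (inj₂ c≡q)
  ... | no c≢p | no c≢q = inj₁ (c≢p , c≢q)
... | inj₁ ok | _ | _ = zero , ok
... | inj₂ _ | inj₁ ok | _ = suc zero , ok
... | inj₂ _ | inj₂ _ | inj₁ ok = suc (suc zero) , ok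
... | inj₂ 0∈ | inj₂ 1∈ | inj₂ 2∈ with ≡-either-of-two (λ ()) 0∈ 1∈ 2∈
...   | inj₁ ()
...   | inj₂ ()

⟨$⟩ʳ-injective : ∀ {m n} (π : Permutation m n) {x y} → π ⟨$⟩ʳ x ≡ π ⟨$⟩ʳ y → x ≡ y
⟨$⟩ʳ-injective π {x} {y} e = trans (sym (inverseˡ π)) (trans (cong (π ⟨$⟩ˡ_) e) (inverseˡ π))

permutation-starting : ∀ {k} (a b : Fin (suc (suc k))) →
                       ∃[ π ] (π ⟨$⟩ʳ zero ≡ a × (a ≡ b ⊎ π ⟨$⟩ʳ suc zero ≡ b))
permutation-starting a b with a ≟ b
... | yes a≡b = insert zero a Perm.id , refl , inj₁ a≡b
... | no a≢b = insert zero a (insert zero (punchOut a≢b) Perm.id) , refl , inj₂ (punchIn-punchOut a≢b)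

rainbow-start : ∀ {k m} → 3 ≤ m → m ≤ k → (a b : Fin k) →
                Σ (ℕ → Fin k) λ f → f 0 ≡ a × (∀ {t t'} → t < m → t' < m → f t ≡ f t' → t ≡ t') × f (pred m) ≢ b
rainbow-start {zero} 3≤m m≤k = contradiction (≤-trans 3≤m m≤k) λ ()
rainbow-start {suc zero} 3≤m m≤k = contradiction (≤-trans 3≤m m≤k) λ { (s≤s ()) }
rainbow-start {suc (suc K)} {suc m} (s≤s 2≤m) m≤k a b with permutation-starting a b
... | π , π0≡a , a≡b⊎π1≡b =
  f , trans (cong (π ⟨$⟩ʳ_) (toℕ-injective (toℕ-clamp {suc K} z≤n))) π0≡a , f-inj , last≢b a≡b⊎π1≡b
  where
  f : ℕ → Fin (suc (suc K))
  f t = π ⟨$⟩ʳ clamp (suc K) t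
  f-inj : ∀ {t t'} → t < suc m → t' < suc m → f t ≡ f t' → t ≡ t'
  f-inj t<m t'<m e = trans (sym (toℕ-clamp (s≤s⁻¹ (<-≤-trans t<m m≤k))))
                           (trans (cong toℕ (⟨$⟩ʳ-injective π e)) (toℕ-clamp (s≤s⁻¹ (<-≤-trans t'<m m≤k))))
  last≢b : a ≡ b ⊎ π ⟨$⟩ʳ suc zero ≡ b → f m ≢ b
  last≢b (inj₁ a≡b) f≡b = contradiction (cong toℕ (⟨$⟩ʳ-injective π (trans f≡b (trans (sym a≡b) (sym π0≡a)))))
                     (λ e → <-irrefl (sym (trans (sym (toℕ-clamp (s≤s⁻¹ m≤k))) e)) (≤-trans (s≤s z≤n) 2≤m))
  last≢b (inj₂ π1≡b) f≡b = contradiction (cong toℕ (⟨$⟩ʳ-injective π (trans f≡b (sym π1≡b))))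
                     (λ e → <-irrefl (sym (trans (sym (toℕ-clamp (s≤s⁻¹ m≤k))) e)) 2≤m)

record EarPalette (k m L : ℕ) (a b : Fin k) : Set where
  field
    hue         : ℕ → Fin k
    hue-first   : hue 0 ≡ a
    hue-last    : hue (pred L) ≡ b
    hue-proper  : ∀ t → suc t < L → hue t ≢ hue (suc t)
    hue-rainbow : ∀ {t t'} → t < m → t' < m → hue t ≡ hue t' → t ≡ t'

-- After the rainbow start, the edges alternate between b and a third colour c₀, arranged to end in b.
earPalette : ∀ {k m L} → 3 ≤ m → m ≤ k → m < L → (a b : Fin k) → EarPalette k m L a b
earPalette {k} {m} {suc L'} 3≤m m≤k (s≤s m≤L') a b = record
  { hue = hue
  ; hue-first = trans (hue-start (≤-trans (s≤s z≤n) 3≤m)) f0≡a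
  ; hue-last = trans (hue-tail m≤L') (cong (alternate b c₀) (n∸n≡0 L'))
  ; hue-proper = hue-proper
  ; hue-rainbow = λ t<m t'<m e → f-inj t<m t'<m (trans (sym (hue-start t<m)) (trans e (hue-start t'<m)))
  }
  where
  start = rainbow-start 3≤m m≤k a b
  f = proj₁ start
  f0≡a = proj₁ (proj₂ start)
  f-inj = proj₁ (proj₂ (proj₂ start))
  f-last≢b = proj₂ (proj₂ (proj₂ start))
  third = avoid-two (≤-trans 3≤m m≤k) b (f (pred m))
  c₀ = proj₁ third

  hue : ℕ → Fin k
  hue t with t <? m
  ... | yes _ = f t
  ... | no _ = alternate b c₀ (suc L' ∸ suc t)

  hue-start : ∀ {t} → t < m → hue t ≡ f t
  hue-start {t} t<m with t <? m
  ... | yes _ = refl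
  ... | no t≮m = contradiction t<m t≮m

  hue-tail : ∀ {t} → m ≤ t → hue t ≡ alternate b c₀ (suc L' ∸ suc t)
  hue-tail {t} m≤t with t <? m
  ... | yes t<m = contradiction m≤t (<⇒≱ t<m)
  ... | no _ = refl

  hue-proper : ∀ t → suc t < suc L' → hue t ≢ hue (suc t)
  hue-proper t t<L' = by-cases (suc t <? m) (suc t ℕ.≟ m)
    where
    by-cases : Dec (suc t < m) → Dec (suc t ≡ m) → hue t ≢ hue (suc t)
    by-cases (yes t+1<m) _ e =
      1+n≢n (sym (f-inj (<-trans (n<1+n t) t+1<m) t+1<m
                   (trans (sym (hue-start (<-trans (n<1+n t) t+1<m))) (trans e (hue-start t+1<m)))))
    by-cases (no _) (yes refl) e with alternate-∈ b c₀ (suc L' ∸ suc (suc t))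
    ... | inj₁ alt≡b = f-last≢b (trans (sym (hue-start (n<1+n t))) (trans e (trans (hue-tail ≤-refl) alt≡b)))
    ... | inj₂ alt≡c₀ = proj₂ (proj₂ third)
                          (sym (trans (sym (hue-start (n<1+n t))) (trans e (trans (hue-tail ≤-refl) alt≡c₀))))
    by-cases (no t+1≮m) (no t+1≢m) e =
      alternate-≢ (proj₁ (proj₂ third) ∘ sym) (suc L' ∸ suc (suc t))
        (sym (trans (cong (alternate b c₀) (sym (+-∸-assoc 1 t<L')))
                    (trans (sym (hue-tail m≤t)) (trans e (hue-tail (≤-trans m≤t (n≤1+n t)))))))
      where
      m≤t : m ≤ t
      m≤t = s≤s⁻¹ (≤∧≢⇒< (≮⇒≥ t+1≮m) (t+1≢m ∘ sym))

module EarEdges {G : Graph} {S S' : VSet G} (R : EarRemoval G S S') where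
  open EarRemoval R

  IsEarEdge : Fin (n G) → Fin (n G) → ℕ → Set
  IsEarEdge u v t = (X t ≡ u × X (suc t) ≡ v) ⊎ (X t ≡ v × X (suc t) ≡ u)

  IsEarEdge? : ∀ u v t → Dec (IsEarEdge u v t)
  IsEarEdge? u v t = ((X t ≟ u) Dec.×-dec (X (suc t) ≟ v)) Dec.⊎-dec ((X t ≟ v) Dec.×-dec (X (suc t) ≟ u))

  IsEarEdge-sym : ∀ {u v t} → IsEarEdge u v t → IsEarEdge v u t
  IsEarEdge-sym (inj₁ e) = inj₂ e
  IsEarEdge-sym (inj₂ e) = inj₁ e

  IsEarEdge-endpoint : ∀ {u v t} → IsEarEdge u v t → ∃[ s ] ((s ≡ t ⊎ s ≡ suc t) × X s ≡ u)
  IsEarEdge-endpoint {t = t} (inj₁ (Xt≡u , _)) = t , inj₁ refl , Xt≡u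
  IsEarEdge-endpoint {t = t} (inj₂ (_ , Xt+1≡u)) = suc t , inj₂ refl , Xt+1≡u

  private
    endpoint≤L : ∀ {s t} → s ≡ t ⊎ s ≡ suc t → t < L → s ≤ L
    endpoint≤L (inj₁ refl) = <⇒≤
    endpoint≤L (inj₂ refl) t<L = t<L

    crossed : ∀ {t t'} → t < L → t' < L → X t ≡ X (suc t') → X (suc t) ≡ X t' → ⊥
    crossed {t} t<L t'<L e₁ e₂ =
      <-irrefl (trans (X-inj (<⇒≤ t<L) t'<L e₁) (cong suc (sym (X-inj t<L (<⇒≤ t'<L) e₂))))
               (<-trans (n<1+n t) (n<1+n (suc t)))

  IsEarEdge-index-unique : ∀ {u v t t'} → t < L → t' < L → IsEarEdge u v t → IsEarEdge u v t' → t ≡ t'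
  IsEarEdge-index-unique t<L t'<L (inj₁ (a₁ , _)) (inj₁ (a₂ , _)) = X-inj (<⇒≤ t<L) (<⇒≤ t'<L) (trans a₁ (sym a₂))
  IsEarEdge-index-unique t<L t'<L (inj₂ (a₁ , _)) (inj₂ (a₂ , _)) = X-inj (<⇒≤ t<L) (<⇒≤ t'<L) (trans a₁ (sym a₂))
  IsEarEdge-index-unique t<L t'<L (inj₁ (a₁ , b₁)) (inj₂ (a₂ , b₂)) =
    ⊥-elim (crossed t<L t'<L (trans a₁ (sym b₂)) (trans b₁ (sym a₂)))
  IsEarEdge-index-unique t<L t'<L (inj₂ (a₁ , b₁)) (inj₁ (a₂ , b₂)) =
    ⊥-elim (crossed t<L t'<L (trans a₁ (sym b₂)) (trans b₁ (sym a₂)))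

  IsEarEdge-same-index : ∀ {u w₁ w₂ t} → t < L → IsEarEdge u w₁ t → IsEarEdge u w₂ t → w₁ ≡ w₂
  IsEarEdge-same-index _ (inj₁ (_ , b₁)) (inj₁ (_ , b₂)) = trans (sym b₁) b₂
  IsEarEdge-same-index _ (inj₂ (a₁ , _)) (inj₂ (a₂ , _)) = trans (sym a₁) a₂
  IsEarEdge-same-index t<L (inj₁ (a₁ , _)) (inj₂ (_ , b₂)) =
    contradiction (X-inj (<⇒≤ t<L) t<L (trans a₁ (sym b₂))) (<⇒≢ (n<1+n _))
  IsEarEdge-same-index t<L (inj₂ (_ , b₁)) (inj₁ (a₂ , _)) =
    contradiction (X-inj (<⇒≤ t<L) t<L (trans a₂ (sym b₁))) (<⇒≢ (n<1+n _))

  IsEarEdge-consecutive : ∀ {u w₁ w₂ t₁ t₂} → t₁ < L → t₂ < L → IsEarEdge u w₁ t₁ → IsEarEdge u w₂ t₂ →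
                          t₁ ≢ t₂ → suc t₁ ≡ t₂ ⊎ suc t₂ ≡ t₁
  IsEarEdge-consecutive {t₁ = t₁} {t₂} t₁<L t₂<L e₁ e₂ t₁≢t₂ with IsEarEdge-endpoint e₁ | IsEarEdge-endpoint e₂
  ... | s₁ , at₁ , X₁ | s₂ , at₂ , X₂ =
    by-cases at₁ at₂ (X-inj (endpoint≤L at₁ t₁<L) (endpoint≤L at₂ t₂<L) (trans X₁ (sym X₂)))
    where
    by-cases : s₁ ≡ t₁ ⊎ s₁ ≡ suc t₁ → s₂ ≡ t₂ ⊎ s₂ ≡ suc t₂ → s₁ ≡ s₂ →
               suc t₁ ≡ t₂ ⊎ suc t₂ ≡ t₁
    by-cases (inj₁ refl) (inj₁ refl) e = contradiction e t₁≢t₂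
    by-cases (inj₁ refl) (inj₂ refl) e = inj₂ (sym e)
    by-cases (inj₂ refl) (inj₁ refl) e = inj₁ e
    by-cases (inj₂ refl) (inj₂ refl) e = contradiction (suc-injective e) t₁≢t₂

  ear-edge-interior-end : ∀ {u v} t → t < L → 1 < L → IsEarEdge u v t → ∃[ s ] (0 < s × s < L × (X s ≡ u ⊎ X s ≡ v))
  ear-edge-interior-end zero _ 1<L (inj₁ (_ , X1≡v)) = 1 , s≤s z≤n , 1<L , inj₂ X1≡v
  ear-edge-interior-end zero _ 1<L (inj₂ (_ , X1≡u)) = 1 , s≤s z≤n , 1<L , inj₁ X1≡u
  ear-edge-interior-end (suc t) t<L _ (inj₁ (Xt≡u , _)) = suc t , s≤s z≤n , t<L , inj₁ Xt≡u
  ear-edge-interior-end (suc t) t<L _ (inj₂ (Xt≡v , _)) = suc t , s≤s z≤n , t<L , inj₂ Xt≡v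

  EdgeIn-S'⇒¬IsEarEdge : 1 < L → ∀ {u v} → EdgeIn G S' u v → ∀ t → t < L → ¬ IsEarEdge u v t
  EdgeIn-S'⇒¬IsEarEdge 1<L (_ , S'u , S'v) t t<L ear with ear-edge-interior-end t t<L 1<L ear
  ... | s , 0<s , s<L , inj₁ refl = contradiction (trans (sym S'u) (X∉S' s 0<s s<L)) λ ()
  ... | s , 0<s , s<L , inj₂ refl = contradiction (trans (sym S'v) (X∉S' s 0<s s<L)) λ ()

  interior⇒IsEarEdge : ∀ {s u w} → 0 < s → s < L → X s ≡ u → adjIn G S u w ≡ true → ∃[ t ] (t < L × IsEarEdge u w t)
  interior⇒IsEarEdge {suc s} _ s<L refl uw with ear-interior-neighbours R s<L uw
  ... | inj₁ w≡prev = s , <-trans (n<1+n s) s<L , inj₂ (sym w≡prev , refl)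
  ... | inj₂ w≡next = suc s , s<L , inj₁ (refl , sym w≡next)

  EdgeIn-S⇒ear-or-S' : ∀ {u w} → EdgeIn G S u w → (∃[ t ] (t < L × IsEarEdge u w t)) ⊎ EdgeIn G S' u w
  EdgeIn-S⇒ear-or-S' {u} {w} uw@(adj-uw , Su , Sw) with S⊆S'∪ear u Su | S⊆S'∪ear w Sw
  ... | inj₂ (s , 0<s , s<L , Xs≡u) | _ = inj₁ (interior⇒IsEarEdge 0<s s<L Xs≡u (EdgeIn⇒adjIn {G = G} {S} uw))
  ... | inj₁ S'u | inj₁ S'w = inj₂ (adj-uw , S'u , S'w)
  ... | inj₁ _ | inj₂ (s , 0<s , s<L , Xs≡w)
          with interior⇒IsEarEdge 0<s s<L Xs≡w (EdgeIn⇒adjIn {G = G} {S} (EdgeIn-sym {G = G} {S} uw))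
  ...   | t , t<L , ear = inj₁ (t , t<L , IsEarEdge-sym ear)

  IsEarEdge-at-S' : ∀ {u w t} → t < L → IsEarEdge u w t → S' u ≡ true → (t ≡ 0 × X 0 ≡ u) ⊎ (suc t ≡ L × X L ≡ u)
  IsEarEdge-at-S' {u} {t = t} t<L ear S'u with IsEarEdge-endpoint ear
  ... | s , at , Xs≡u with s ℕ.≟ 0 | s ℕ.≟ L
  ...   | yes refl | _ = inj₁ (start at , Xs≡u)
    where
    start : 0 ≡ t ⊎ 0 ≡ suc t → t ≡ 0
    start (inj₁ e) = sym e
  ...   | no _ | yes refl = inj₂ (end at , Xs≡u)
    where
    end : L ≡ t ⊎ L ≡ suc t → suc t ≡ L
    end (inj₁ e) = contradiction (sym e) (<⇒≢ t<L)
    end (inj₂ e) = sym e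
  ...   | no s≢0 | no s≢L =
    contradiction (trans (sym S'u) (trans (cong S' (sym Xs≡u)) (X∉S' s (n≢0⇒n>0 s≢0) (≤∧≢⇒< (endpoint≤L at t<L) s≢L))))
                  λ ()

module ExtendOverEar {r G k} (3≤r : 3 ≤ r) (3≤k : 3 ≤ k) (Δ≤k : maxDeg G ≤ k) (forest⊎r≤k : IsForest G ⊎ r ≤ k)
                     {S S' : VSet G} (g : RAcyclicOn r G k S') (R : EarRemoval G S S') (r<L : r < EarRemoval.L R) where
  open EarRemoval R
  open EarEdges R

  private
    c = colour g

    1<L : 1 < L
    1<L = ≤-trans (s≤s (≤-trans (s≤s z≤n) 3≤r)) r<L

    L' = pred L
    1+L'≡L : suc L' ≡ L
    1+L'≡L = suc-pred L {{ℕ.>-nonZero (<-trans (s≤s z≤n) 1<L)}}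
    L'<L : L' < L
    L'<L = subst (L' <_) 1+L'≡L ≤-refl

    m = r ⊓ k
    m<L : m < L
    m<L = ≤-<-trans (m⊓n≤m r k) r<L

    MissingAt : Fin (n G) → Fin k → Set
    MissingAt u a = ∀ w → adjIn G S' u w ≡ true → c u w ≢ a

    spare-start : ∃ (MissingAt (X 0))
    spare-start = missing-colour-after-removal {G = G} {S = S} c Δ≤k S'⊆S
                    (ear-adjIn R (<-trans (s≤s z≤n) 1<L)) (X∉S' 1 (s≤s z≤n) 1<L)

    spare-end : ∃ (MissingAt (X L))
    spare-end = missing-colour-after-removal {G = G} {S = S} c Δ≤k S'⊆S
                  (subst (λ z → adjIn G S (X z) (X L') ≡ true) 1+L'≡L (ear-adjIn-back R L'<L))
                  (X∉S' L' (s≤s⁻¹ (subst (2 ≤_) (sym 1+L'≡L) 1<L)) L'<L)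

    cycle⇒r≤k : Cycle G → r ≤ k
    cycle⇒r≤k C = [ contradiction C , id ]′ forest⊎r≤k

    palette = earPalette (⊓-glb 3≤r 3≤k) (m⊓n≤n r k) m<L (proj₁ spare-start) (proj₁ spare-end)
    open EarPalette palette

  recoloured : Fin (n G) → Fin (n G) → Fin k
  recoloured u v with any? (λ (i : Fin L) → IsEarEdge? u v (toℕ i))
  ... | yes (i , _) = hue (toℕ i)
  ... | no _ = c u v

  private
    recoloured-ear : ∀ {u v t} → t < L → IsEarEdge u v t → recoloured u v ≡ hue t
    recoloured-ear {u} {v} t<L ear with any? (λ (i : Fin L) → IsEarEdge? u v (toℕ i))
    ... | yes (i , ear′) = cong hue (IsEarEdge-index-unique (toℕ<n i) t<L ear′ ear)
    ... | no none = contradiction (fromℕ< t<L , subst (IsEarEdge u v) (sym (toℕ-fromℕ< t<L)) ear) none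

    recoloured-S' : ∀ {u v} → EdgeIn G S' u v → recoloured u v ≡ c u v
    recoloured-S' {u} {v} uv with any? (λ (i : Fin L) → IsEarEdge? u v (toℕ i))
    ... | yes (i , ear) = contradiction ear (EdgeIn-S'⇒¬IsEarEdge 1<L uv (toℕ i) (toℕ<n i))
    ... | no _ = refl

    recoloured-sym : ∀ {u w} → EdgeIn G S u w → recoloured u w ≡ recoloured w u
    recoloured-sym uw with EdgeIn-S⇒ear-or-S' uw
    ... | inj₁ (t , t<L , ear) = trans (recoloured-ear t<L ear) (sym (recoloured-ear t<L (IsEarEdge-sym ear)))
    ... | inj₂ uw′ = trans (recoloured-S' uw′)
                       (trans (colour-sym g uw′) (sym (recoloured-S' (EdgeIn-sym {G = G} {S'} uw′))))

    -- The only ear edges meeting G[S'] are the end edges, whose colours are missing there.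
    ear-vs-old : ∀ {u w₁ w₂ t} → t < L → IsEarEdge u w₁ t → EdgeIn G S' u w₂ → recoloured u w₁ ≢ recoloured u w₂
    ear-vs-old {u} {w₁} {w₂} t<L ear uw₂ e with IsEarEdge-at-S' t<L ear (proj₁ (proj₂ uw₂))
    ... | inj₁ (refl , refl) =
      proj₂ spare-start w₂ (EdgeIn⇒adjIn {G = G} {S'} uw₂)
        (trans (sym (recoloured-S' uw₂)) (trans (sym e) (trans (recoloured-ear t<L ear) hue-first)))
    ... | inj₂ (1+t≡L , refl) =
      proj₂ spare-end w₂ (EdgeIn⇒adjIn {G = G} {S'} uw₂)
        (trans (sym (recoloured-S' uw₂))
          (trans (sym e) (trans (recoloured-ear t<L ear) (trans (cong hue (cong pred 1+t≡L)) hue-last))))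

    recoloured-proper : ∀ {u w₁ w₂} → EdgeIn G S u w₁ → EdgeIn G S u w₂ → w₁ ≢ w₂ →
                        recoloured u w₁ ≢ recoloured u w₂
    recoloured-proper uw₁ uw₂ w₁≢w₂ with EdgeIn-S⇒ear-or-S' uw₁ | EdgeIn-S⇒ear-or-S' uw₂
    ... | inj₁ (t₁ , t₁<L , ear₁) | inj₁ (t₂ , t₂<L , ear₂) = both-ear (t₁ ℕ.≟ t₂)
      where
      both-ear : Dec (t₁ ≡ t₂) → recoloured _ _ ≢ recoloured _ _
      both-ear (yes refl) _ = w₁≢w₂ (IsEarEdge-same-index t₁<L ear₁ ear₂)
      both-ear (no t₁≢t₂) e with IsEarEdge-consecutive t₁<L t₂<L ear₁ ear₂ t₁≢t₂
      ... | inj₁ refl = hue-proper t₁ t₂<L (trans (sym (recoloured-ear t₁<L ear₁)) (trans e (recoloured-ear t₂<L ear₂)))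
      ... | inj₂ refl = hue-proper t₂ t₁<L (trans (sym (recoloured-ear t₂<L ear₂)) (trans (sym e) (recoloured-ear t₁<L ear₁)))
    ... | inj₁ (t₁ , t₁<L , ear₁) | inj₂ uw₂′ = ear-vs-old t₁<L ear₁ uw₂′
    ... | inj₂ uw₁′ | inj₁ (t₂ , t₂<L , ear₂) = ear-vs-old t₂<L ear₂ uw₁′ ∘ sym
    ... | inj₂ uw₁′ | inj₂ uw₂′ = λ e →
      colour-proper g uw₁′ uw₂′ w₁≢w₂ (trans (sym (recoloured-S' uw₁′)) (trans e (recoloured-S' uw₂′)))

    -- A cycle through the ear contains all its edges, in particular the m rainbow ones.
    recoloured-acyclic : ∀ C → CycleIn G S C → SeesColours recoloured C (cycleLength C ⊓ r)
    recoloured-acyclic C C⊆S with cycleIn-or-leaves S' C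
    ... | inj₁ C⊆S' = SeesColours-cong {c = c} {recoloured} C
                        (λ i → sym (recoloured-S' (cadj C i , C⊆S' i , C⊆S' (csuc i)))) (colour-acyclic g C C⊆S')
    ... | inj₂ (i , i∉S') with cycle-meets-ear R C C⊆S i i∉S'
    ...   | m₀ , 0<m₀ , m₀<L , on =
      tabulate (hue ∘ toℕ) ,
      Unique.tabulate⁺ (λ {t} {t'} e → toℕ-injective (hue-rainbow (toℕ<n t) (toℕ<n t') e)) ,
      subst (cycleLength C ⊓ r ≤_) (trans (sym (m≤n⇒m⊓n≡m (cycle⇒r≤k C))) (sym (length-tabulate (hue ∘ toℕ))))
            (m⊓n≤n _ r) ,
      AllP.tabulate⁺ (λ t → seen (toℕ t) (toℕ<n t))
      where
      seen : ∀ t → t < m → ∃[ i ] (recoloured (cv C i) (cv C (csuc i)) ≡ hue t)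
      seen t t<m with ear-edges-on-cycle R C C⊆S 0<m₀ m₀<L on t (<-trans t<m m<L)
      ... | i , inj₁ (p , q) = i , recoloured-ear (<-trans t<m m<L) (inj₁ (sym p , sym q))
      ... | i , inj₂ (p , q) = i , recoloured-ear (<-trans t<m m<L) (inj₂ (sym q , sym p))

  colouring : RAcyclicOn r G k S
  colouring = record { colour = recoloured ; colour-sym = recoloured-sym ; colour-proper = recoloured-proper
                     ; colour-acyclic = recoloured-acyclic }

Reduces⇒RAcyclicOn : ∀ {r G k} → 3 ≤ r → 3 ≤ k → maxDeg G ≤ k → IsForest G ⊎ r ≤ k →
                     ∀ {S} → Reduces (suc r) G S → RAcyclicOn r G k S
Reduces⇒RAcyclicOn 3≤r 3≤k Δ≤k forest⊎r≤k (done S≡∅) = RAcyclicOn-∅ (≤-trans (s≤s z≤n) 3≤k) S≡∅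
Reduces⇒RAcyclicOn 3≤r 3≤k Δ≤k forest⊎r≤k (step (delVertex v Sv deg≤1 S'-spec) red) =
  ExtendOverVertex.colouring Δ≤k (≤-trans (s≤s z≤n) 3≤k) (Reduces⇒RAcyclicOn 3≤r 3≤k Δ≤k forest⊎r≤k red)
                             Sv deg≤1 S'-spec
Reduces⇒RAcyclicOn 3≤r 3≤k Δ≤k forest⊎r≤k (step (delEar E r<ℓ S'-spec) red) =
  ExtendOverEar.colouring 3≤r 3≤k Δ≤k forest⊎r≤k (Reduces⇒RAcyclicOn 3≤r 3≤k Δ≤k forest⊎r≤k red)
                          (earRemoval E S'-spec) r<ℓ

mainTheorem15 : (r : ℕ) → 3 ≤ r → (G : Graph) → PathDegenerate (suc r) G →
                3 ≤ maxDeg G →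
                (IsForest G → GenAcyclicIndex≡ r G (maxDeg G)) ×
                (¬ IsForest G → GenAcyclicIndex≡ r G (maxDeg G ⊔ r))
mainTheorem15 r 3≤r G degenerate 3≤Δ = forest-case , cyclic-case
  where
  colouring : ∀ {k} → 3 ≤ k → maxDeg G ≤ k → IsForest G ⊎ r ≤ k → HasRAcyclicColouring r G k
  colouring 3≤k Δ≤k forest⊎r≤k = RAcyclicOn-full⇒colouring (Reduces⇒RAcyclicOn 3≤r 3≤k Δ≤k forest⊎r≤k degenerate)

  forest-case : IsForest G → GenAcyclicIndex≡ r G (maxDeg G)
  forest-case forest = colouring 3≤Δ ≤-refl (inj₁ forest) , λ _ (c , _) → maxDeg≤colours c

  r≤cycleLength : (C : Cycle G) → r ≤ cycleLength C
  r≤cycleLength C = ≤-trans (n≤1+n r) (<⇒≤ (Reduces⇒long-cycles degenerate C (λ _ → refl)))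

  cyclic-case : ¬ IsForest G → GenAcyclicIndex≡ r G (maxDeg G ⊔ r)
  cyclic-case cyclic = colouring (≤-trans 3≤Δ (m≤m⊔n _ r)) (m≤m⊔n _ r) (inj₂ (m≤n⊔m _ r)) ,
    λ k (c , acyclic) → ⊔-lub (maxDeg≤colours c)
      (decidable-stable (r ≤? k) λ r≰k → cyclic λ C → r≰k (r≤colours c acyclic C (r≤cycleLength C)))
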